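{- Let $N$ be a positive perfect square and let $H$ be the undirected unweighted graph with vertex set the disjoint union of $A=\{a[i,j]\}$, $B=\{b[i,j,k]\}$, $C=\{c[i,j,k]\}$, $D=\{d[i,j]\}$, where indices $i,j,x,y$ range over $[\sqrt N]$ and $k,z$ over $\{0,1\}$, and whose edges are exactly: $\{b[i,j,k],b[x,y,z]\}$ iff exactly one of $i=x$, $j=y$ holds; $\{c[i,j,k],c[x,y,z]\}$ iff exactly one of $i=x$, $j=y$ holds; $\{a[i,j],b[x,y,z]\}$ iff $i=x$ and $z=0$; $\{b[i,j,k],c[x,y,z]\}$ iff $i=x$ and $j=y$; $\{c[i,j,k],d[x,y]\}$ iff $j=y$ and $k=0$ (no other edges). Let $M$ be an arbitrary binary $\sqrt N\times\sqrt N\times\sqrt N$ array, and let $G\supseteq H$ be obtained by adding the edge $\{a[i,j],b[i,y,1]\}$ for all $i,j,y$ with $M[i,j,y]=1$, and the edge $\{c[i,y,1],d[x,y]\}$ for all $i,x,y$ with $M[i,x,y]=1$. For indices $i,j,x,y\in[\sqrt N]$ with $i\ne x$ and $j\ne y$, let $F=\{\{a[i,j],b[i,y,0]\},\{c[i,y,0],d[x,y]\}\}$. Then the diameter of $G-F$ is at most $3$ if $M[i,j,y]=M[i,x,y]=1$, and at least $5$ if $M[i,j,y]=M[i,x,y]=0$.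
   Context: $G-F$ denotes $G$ with the edges of $F$ removed. The diameter of an unweighted graph is the maximum over vertex pairs of the shortest-path distance (number of edges). -}

module Defs where

open import Data.Nat using (ℕ; zero; suc; _≤_)
open import Data.Fin using (Fin)
open import Data.Bool using (Bool; true; false)
open import Data.Product using (Σ; _×_; ∃; ∃-syntax)
open import Data.Sum using (_⊎_)
open import Data.Empty using (⊥)
open import Data.Unit using (⊤)
open import Relation.Nullary using (¬_)
open import Relation.Binary.PropositionalEquality using (_≡_)

-- Indices range over Fin n where n = √N; the bit k ∈ {0,1} is a Bool
-- with false = 0 and true = 1.
data V (n : ℕ) : Set where
  a : Fin n → Fin n → V n
  b : Fin n → Fin n → Bool → V n
  c : Fin n → Fin n → Bool → V n
  d : Fin n → Fin n → V n

ExactlyOne : {n : ℕ} → Fin n → Fin n → Fin n → Fin n → Set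
ExactlyOne i j x y = (i ≡ x × ¬ (j ≡ y)) ⊎ (¬ (i ≡ x) × j ≡ y)

-- The edges of H, in the orientation listed in the paper (symmetrised below).
HEdge : {n : ℕ} → V n → V n → Set
HEdge (b i j k) (b x y z) = ExactlyOne i j x y
HEdge (c i j k) (c x y z) = ExactlyOne i j x y
HEdge (a i j)   (b x y z) = i ≡ x × z ≡ false
HEdge (b i j k) (c x y z) = i ≡ x × j ≡ y
HEdge (c i j k) (d x y)   = j ≡ y × k ≡ false
HEdge _ _ = ⊥

MEdge : {n : ℕ} → (Fin n → Fin n → Fin n → Bool) → V n → V n → Set
MEdge M (a i j)    (b x y z) = i ≡ x × z ≡ true × M i j y ≡ true
MEdge M (c i y' k) (d x y)   = y' ≡ y × k ≡ true × M i x y ≡ true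
MEdge M _ _ = ⊥

GAdj : {n : ℕ} → (Fin n → Fin n → Fin n → Bool) → V n → V n → Set
GAdj M u v = (HEdge u v ⊎ MEdge M u v) ⊎ (HEdge v u ⊎ MEdge M v u)

FDir : {n : ℕ} → Fin n → Fin n → Fin n → Fin n → V n → V n → Set
FDir i j x y u v = (u ≡ a i j × v ≡ b i y false) ⊎ (u ≡ c i y false × v ≡ d x y)

InF : {n : ℕ} → Fin n → Fin n → Fin n → Fin n → V n → V n → Set
InF i j x y u v = FDir i j x y u v ⊎ FDir i j x y v u

GFAdj : {n : ℕ} → (Fin n → Fin n → Fin n → Bool) → Fin n → Fin n → Fin n → Fin n →
        V n → V n → Set
GFAdj M i j x y u v = GAdj M u v × ¬ InF i j x y u v

data Walk {A : Set} (R : A → A → Set) : ℕ → A → A → Set where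
  nil  : ∀ {u} → Walk R zero u u
  cons : ∀ {ℓ u w v} → R u w → Walk R ℓ w v → Walk R (suc ℓ) u v

DistLe : {A : Set} → (A → A → Set) → A → A → ℕ → Set
DistLe R u v m = Σ ℕ (λ ℓ → ℓ ≤ m × Walk R ℓ u v)

DiamLe : {A : Set} → (A → A → Set) → ℕ → Set
DiamLe {A} R m = (u v : A) → DistLe R u v m

-- diameter ≥ m : some pair of vertices is at distance ≥ m
-- (i.e. not at distance ≤ m - 1; includes the disconnected case)
DiamGe : {A : Set} → (A → A → Set) → ℕ → Set
DiamGe {A} R zero    = ⊤
DiamGe {A} R (suc m) = Σ A (λ u → Σ A (λ v → ¬ DistLe R u v m))

{-# OPTIONS --safe #-}
-- Upper bound: with both M-entries equal to 1, the removed edges are bypassed by the M-edges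
-- a[i,j]–b[i,y,1] and c[i,y,1]–d[x,y], and every pair of vertices is joined by an explicit
-- path of length at most 3 through the rows and columns of the B- and C-layers.
-- Lower bound: with both entries 0, the level 1 + [p ≠ i] + [q = y] of b[p,q,·] (one more on
-- c[p,q,·], suitably extended to A and D) changes by at most 1 along every edge of G − F, while
-- a[i,j] has level 0 and d[x,y] has level 5.
module Submission where

open import Defs
open import Data.Nat using (ℕ; suc; _+_; _≤_; z≤n; s≤s; ∣_-_∣)
open import Data.Nat.Properties
  using ( ≤-trans; ≤-reflexive; +-mono-≤; +-comm; 1+n≰n
        ; ∣n-n∣≡0; ∣-∣-triangle; ∣-∣-comm; ∣m+n-m+o∣≡∣n-o∣; ∣m-m+n∣≡n )
open import Data.Fin using (Fin; _≟_)
open import Data.Bool using (Bool; true; false)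
open import Data.Product using (_×_; _,_; proj₂; ∃-syntax)
open import Data.Sum using (_⊎_; inj₁; inj₂; swap)
open import Data.Empty using (⊥-elim)
open import Relation.Nullary using (¬_; yes; no; contradiction)
open import Relation.Nullary.Decidable using (isYes; isNo; _×-dec_)
open import Relation.Binary.Definitions using (Symmetric)
open import Relation.Binary.PropositionalEquality using (_≡_; refl; sym; trans; cong₂; subst)

module _ {A : Set} {R : A → A → Set} where

  done : ∀ {u m} → DistLe R u u m
  done = 0 , z≤n , nil

  infixr 5 _◅_
  _◅_ : ∀ {u w v m} → R u w → DistLe R w v m → DistLe R u v (suc m)
  e ◅ (ℓ , ℓ≤m , p) = suc ℓ , s≤s ℓ≤m , cons e p

  module _ (R-sym : Symmetric R) where

    Walk-snoc : ∀ {ℓ u w v} → Walk R ℓ u w → R w v → Walk R (suc ℓ) u v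
    Walk-snoc nil        e′ = cons e′ nil
    Walk-snoc (cons e p) e′ = cons e (Walk-snoc p e′)

    Walk-reverse : ∀ {ℓ u v} → Walk R ℓ u v → Walk R ℓ v u
    Walk-reverse nil        = nil
    Walk-reverse (cons e p) = Walk-snoc (Walk-reverse p) (R-sym e)

    DistLe-sym : ∀ {u v m} → DistLe R u v m → DistLe R v u m
    DistLe-sym (ℓ , ℓ≤m , p) = ℓ , ℓ≤m , Walk-reverse p

  module _ (h : A → ℕ) (h-lip : ∀ {u v} → R u v → ∣ h u - h v ∣ ≤ 1) where

    ∣-∣≤length : ∀ {ℓ u v} → Walk R ℓ u v → ∣ h u - h v ∣ ≤ ℓ
    ∣-∣≤length {u = u} nil = ≤-reflexive (∣n-n∣≡0 (h u))
    ∣-∣≤length {u = u} {v} (cons {w = w} e p) =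
      ≤-trans (∣-∣-triangle (h u) (h w) (h v)) (+-mono-≤ (h-lip e) (∣-∣≤length p))

    ∣-∣≤dist : ∀ {u v m} → DistLe R u v m → ∣ h u - h v ∣ ≤ m
    ∣-∣≤dist (ℓ , ℓ≤m , p) = ≤-trans (∣-∣≤length p) ℓ≤m

∣m+o-n+o∣≡∣m-n∣ : ∀ m n o → ∣ m + o - n + o ∣ ≡ ∣ m - n ∣
∣m+o-n+o∣≡∣m-n∣ m n o = trans (cong₂ ∣_-_∣ (+-comm m o) (+-comm n o)) (∣m+n-m+o∣≡∣n-o∣ o m n)

∣n-1+n∣≡1 : ∀ n → ∣ n - suc n ∣ ≡ 1
∣n-1+n∣≡1 n = subst (λ k → ∣ n - k ∣ ≡ 1) (+-comm n 1) (∣m-m+n∣≡n n 1)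

module Edges {n : ℕ} (M : Fin n → Fin n → Fin n → Bool) (i j x y : Fin n) where

  R : V n → V n → Set
  R = GFAdj M i j x y

  R-sym : Symmetric R
  R-sym (uv , uv∉F) = swap uv , λ vu∈F → uv∉F (swap vu∈F)

  bb : ∀ {p q p′ q′ k k′} → ExactlyOne p q p′ q′ → R (b p q k) (b p′ q′ k′)
  bb e = inj₁ (inj₁ e) , λ { (inj₁ (inj₁ (() , _))) ; (inj₁ (inj₂ (() , _)))
                           ; (inj₂ (inj₁ (() , _))) ; (inj₂ (inj₂ (() , _))) }

  cc : ∀ {p q p′ q′ k k′} → ExactlyOne p q p′ q′ → R (c p q k) (c p′ q′ k′)
  cc e = inj₁ (inj₁ e) , λ { (inj₁ (inj₁ (() , _))) ; (inj₁ (inj₂ (_ , ())))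
                           ; (inj₂ (inj₁ (() , _))) ; (inj₂ (inj₂ (_ , ()))) }

  bc : ∀ {p q k k′} → R (b p q k) (c p q k′)
  bc = inj₁ (inj₁ (refl , refl)) , λ { (inj₁ (inj₁ (() , _))) ; (inj₁ (inj₂ (() , _)))
                                     ; (inj₂ (inj₁ (() , _))) ; (inj₂ (inj₂ (_ , ()))) }

  ab₀ : ∀ {p q s} → ¬ (p ≡ i × q ≡ j × s ≡ y) → R (a p q) (b p s false)
  ab₀ ¬F = inj₁ (inj₁ (refl , refl)) ,
    λ { (inj₁ (inj₁ (refl , refl))) → ¬F (refl , refl , refl) ; (inj₁ (inj₂ (() , _)))
      ; (inj₂ (inj₁ (() , _))) ; (inj₂ (inj₂ (() , _))) }

  ab₁ : ∀ {p q s} → M p q s ≡ true → R (a p q) (b p s true)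
  ab₁ m = inj₁ (inj₂ (refl , refl , m)) ,
    λ { (inj₁ (inj₁ (_ , ()))) ; (inj₁ (inj₂ (() , _)))
      ; (inj₂ (inj₁ (() , _))) ; (inj₂ (inj₂ (() , _))) }

  cd₀ : ∀ {p q p′} → ¬ (p ≡ i × q ≡ y × p′ ≡ x) → R (c p q false) (d p′ q)
  cd₀ ¬F = inj₁ (inj₁ (refl , refl)) ,
    λ { (inj₁ (inj₁ (() , _))) ; (inj₁ (inj₂ (refl , refl))) → ¬F (refl , refl , refl)
      ; (inj₂ (inj₁ (() , _))) ; (inj₂ (inj₂ (() , _))) }

  cd₁ : ∀ {p q p′} → M p p′ q ≡ true → R (c p q true) (d p′ q)
  cd₁ m = inj₁ (inj₂ (refl , refl , m)) ,
    λ { (inj₁ (inj₁ (() , _))) ; (inj₁ (inj₂ (() , _)))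
      ; (inj₂ (inj₁ (() , _))) ; (inj₂ (inj₂ (() , _))) }

module UpperBound {n : ℕ} (M : Fin n → Fin n → Fin n → Bool) (i j x y : Fin n)
                  (i≢x : ¬ i ≡ x) (j≢y : ¬ j ≡ y)
                  (Mijy : M i j y ≡ true) (Mixy : M i x y ≡ true) where
  open Edges M i j x y

  a-b-edge : ∀ p q s → ∃[ z ] R (a p q) (b p s z)
  a-b-edge p q s with (p ≟ i) ×-dec ((q ≟ j) ×-dec (s ≟ y))
  ... | yes (refl , refl , refl) = true , ab₁ Mijy
  ... | no ¬F                    = false , ab₀ ¬F

  c-d-edge : ∀ p q p′ → ∃[ k ] R (c p q k) (d p′ q)
  c-d-edge p q p′ with (p ≟ i) ×-dec ((q ≟ y) ×-dec (p′ ≟ x))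
  ... | yes (refl , refl , refl) = true , cd₁ Mixy
  ... | no ¬F                    = false , cd₀ ¬F

  a-bⱼ : ∀ p q → R (a p q) (b p j false)
  a-bⱼ p q = ab₀ (λ (_ , _ , j≡y) → j≢y j≡y)

  cₓ-d : ∀ p q → R (c x q false) (d p q)
  cₓ-d p q = cd₀ (λ (i≡x , _) → i≢x (sym i≡x))

  dist-b-b : ∀ {m} p q p′ q′ k k′ → DistLe R (b p q k) (b p′ q′ k′) (2 + m)
  dist-b-b p q p′ q′ k k′ with p ≟ p′ | q ≟ q′
  ... | yes refl | yes refl = bc {k′ = false} ◅ R-sym bc ◅ done
  ... | yes refl | no q≢q′  = bb (inj₁ (refl , q≢q′)) ◅ done
  ... | no p≢p′  | yes refl = bb (inj₂ (p≢p′ , refl)) ◅ done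
  ... | no p≢p′  | no q≢q′  = bb {k′ = false} (inj₁ (refl , q≢q′)) ◅ bb (inj₂ (p≢p′ , refl)) ◅ done

  dist-c-c : ∀ {m} p q p′ q′ k k′ → DistLe R (c p q k) (c p′ q′ k′) (2 + m)
  dist-c-c p q p′ q′ k k′ with p ≟ p′ | q ≟ q′
  ... | yes refl | yes refl = R-sym (bc {k = false}) ◅ bc ◅ done
  ... | yes refl | no q≢q′  = cc (inj₁ (refl , q≢q′)) ◅ done
  ... | no p≢p′  | yes refl = cc (inj₂ (p≢p′ , refl)) ◅ done
  ... | no p≢p′  | no q≢q′  = cc {k′ = false} (inj₁ (refl , q≢q′)) ◅ cc (inj₂ (p≢p′ , refl)) ◅ done

  dist-a-a : ∀ p q p′ q′ → DistLe R (a p q) (a p′ q′) 3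
  dist-a-a p q p′ q′ with p ≟ p′
  ... | yes refl = a-bⱼ p q ◅ R-sym (a-bⱼ p q′) ◅ done
  ... | no p≢p′  = a-bⱼ p q ◅ bb (inj₂ (p≢p′ , refl)) ◅ R-sym (a-bⱼ p′ q′) ◅ done

  dist-a-b : ∀ p q p′ q′ k → DistLe R (a p q) (b p′ q′ k) 3
  dist-a-b p q p′ q′ k = proj₂ (a-b-edge p q q′) ◅ dist-b-b p q′ p′ q′ _ k

  dist-a-c : ∀ p q p′ q′ k → DistLe R (a p q) (c p′ q′ k) 3
  dist-a-c p q p′ q′ k with p ≟ p′
  ... | yes refl = proj₂ (a-b-edge p q q′) ◅ bc ◅ done
  ... | no p≢p′  = proj₂ (a-b-edge p q q′) ◅ bb {k′ = false} (inj₂ (p≢p′ , refl)) ◅ bc ◅ done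

  dist-a-d : ∀ p q p′ q′ → DistLe R (a p q) (d p′ q′) 3
  dist-a-d p q p′ q′ = proj₂ (a-b-edge p q q′) ◅ bc ◅ proj₂ (c-d-edge p q′ p′) ◅ done

  dist-b-c : ∀ p q p′ q′ k k′ → DistLe R (b p q k) (c p′ q′ k′) 3
  dist-b-c p q p′ q′ k k′ = bc {k′ = false} ◅ dist-c-c p q p′ q′ false k′

  dist-b-d : ∀ p q p′ q′ k → DistLe R (b p q k) (d p′ q′) 3
  dist-b-d p q p′ q′ k with q ≟ q′
  ... | yes refl = bc ◅ proj₂ (c-d-edge p q p′) ◅ done
  ... | no q≢q′  = bb {k′ = false} (inj₁ (refl , q≢q′)) ◅ bc ◅ proj₂ (c-d-edge p q′ p′) ◅ done

  dist-d-c : ∀ p q p′ q′ k → DistLe R (d p q) (c p′ q′ k) 3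
  dist-d-c p q p′ q′ k = R-sym (proj₂ (c-d-edge p′ q p)) ◅ dist-c-c p′ q p′ q′ _ k

  dist-d-d : ∀ p q p′ q′ → DistLe R (d p q) (d p′ q′) 3
  dist-d-d p q p′ q′ with q ≟ q′
  ... | yes refl = R-sym (cₓ-d p q) ◅ cₓ-d p′ q ◅ done
  ... | no q≢q′  = R-sym (cₓ-d p q) ◅ cc (inj₁ (refl , q≢q′)) ◅ cₓ-d p′ q′ ◅ done

  diam≤3 : DiamLe R 3
  diam≤3 (a p q)   (a p′ q′)    = dist-a-a p q p′ q′
  diam≤3 (a p q)   (b p′ q′ k′) = dist-a-b p q p′ q′ k′
  diam≤3 (a p q)   (c p′ q′ k′) = dist-a-c p q p′ q′ k′
  diam≤3 (a p q)   (d p′ q′)    = dist-a-d p q p′ q′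
  diam≤3 (b p q k) (a p′ q′)    = DistLe-sym R-sym (dist-a-b p′ q′ p q k)
  diam≤3 (b p q k) (b p′ q′ k′) = dist-b-b p q p′ q′ k k′
  diam≤3 (b p q k) (c p′ q′ k′) = dist-b-c p q p′ q′ k k′
  diam≤3 (b p q k) (d p′ q′)    = dist-b-d p q p′ q′ k
  diam≤3 (c p q k) (a p′ q′)    = DistLe-sym R-sym (dist-a-c p′ q′ p q k)
  diam≤3 (c p q k) (b p′ q′ k′) = DistLe-sym R-sym (dist-b-c p′ q′ p q k′ k)
  diam≤3 (c p q k) (c p′ q′ k′) = dist-c-c p q p′ q′ k k′
  diam≤3 (c p q k) (d p′ q′)    = DistLe-sym R-sym (dist-d-c p′ q′ p q k)
  diam≤3 (d p q)   (a p′ q′)    = DistLe-sym R-sym (dist-a-d p′ q′ p q)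
  diam≤3 (d p q)   (b p′ q′ k′) = DistLe-sym R-sym (dist-b-d p′ q′ p q k′)
  diam≤3 (d p q)   (c p′ q′ k′) = dist-d-c p q p′ q′ k′
  diam≤3 (d p q)   (d p′ q′)    = dist-d-d p q p′ q′

module LowerBound {n : ℕ} (M : Fin n → Fin n → Fin n → Bool) (i j x y : Fin n)
                  (Mijy : M i j y ≡ false) (Mixy : M i x y ≡ false) where
  open Edges M i j x y using (R)

  𝟙 : Bool → ℕ
  𝟙 true  = 1
  𝟙 false = 0

  ∣𝟙-𝟙∣≤1 : ∀ s t → ∣ 𝟙 s - 𝟙 t ∣ ≤ 1
  ∣𝟙-𝟙∣≤1 true  true  = z≤n
  ∣𝟙-𝟙∣≤1 true  false = s≤s z≤n
  ∣𝟙-𝟙∣≤1 false true  = s≤s z≤n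
  ∣𝟙-𝟙∣≤1 false false = z≤n

  offset : Fin n → Fin n → ℕ
  offset p q = 𝟙 (isNo (p ≟ i)) + 𝟙 (isYes (q ≟ y))

  offset-near : ∀ {p q p′ q′} → ExactlyOne p q p′ q′ → ∣ offset p q - offset p′ q′ ∣ ≤ 1
  offset-near {p} {q} {_} {q′} (inj₁ (refl , _)) =
    ≤-trans (≤-reflexive (∣m+n-m+o∣≡∣n-o∣ (𝟙 (isNo (p ≟ i))) _ _))
            (∣𝟙-𝟙∣≤1 (isYes (q ≟ y)) (isYes (q′ ≟ y)))
  offset-near {p} {q} {p′} (inj₂ (_ , refl)) =
    ≤-trans (≤-reflexive (∣m+o-n+o∣≡∣m-n∣ (𝟙 (isNo (p ≟ i))) (𝟙 (isNo (p′ ≟ i))) _))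
            (∣𝟙-𝟙∣≤1 (isNo (p ≟ i)) (isNo (p′ ≟ i)))

  level : V n → ℕ
  level (a p q) with p ≟ i | q ≟ j
  ... | yes _ | yes _ = 0
  ... | yes _ | no _  = 2
  ... | no _  | _     = 3
  level (b p q _) = 1 + offset p q
  level (c p q _) = 2 + offset p q
  level (d p q) with q ≟ y | p ≟ x
  ... | yes _ | yes _ = 5
  ... | yes _ | no _  = 4
  ... | no _  | _     = 3

  ab-near : ∀ p q s z → ¬ (p ≡ i × q ≡ j × s ≡ y) → ∣ level (a p q) - level (b p s z) ∣ ≤ 1
  ab-near p q s z ¬F with p ≟ i | q ≟ j | s ≟ y
  ... | yes p≡i | yes q≡j | yes s≡y = ⊥-elim (¬F (p≡i , q≡j , s≡y))
  ... | yes _   | yes _   | no _    = s≤s z≤n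
  ... | yes _   | no _    | yes _   = z≤n
  ... | yes _   | no _    | no _    = s≤s z≤n
  ... | no _    | _       | yes _   = z≤n
  ... | no _    | _       | no _    = s≤s z≤n

  cd-near : ∀ t q k p → ¬ (t ≡ i × q ≡ y × p ≡ x) → ∣ level (c t q k) - level (d p q) ∣ ≤ 1
  cd-near t q k p ¬F with t ≟ i | q ≟ y | p ≟ x
  ... | yes t≡i | yes q≡y | yes p≡x = ⊥-elim (¬F (t≡i , q≡y , p≡x))
  ... | yes _   | yes _   | no _    = s≤s z≤n
  ... | no _    | yes _   | yes _   = s≤s z≤n
  ... | no _    | yes _   | no _    = z≤n
  ... | yes _   | no _    | _       = s≤s z≤n
  ... | no _    | no _    | _       = z≤n

  level-aᵢⱼ : level (a i j) ≡ 0
  level-aᵢⱼ with i ≟ i | j ≟ j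
  ... | yes _   | yes _   = refl
  ... | yes _   | no j≢j  = contradiction refl j≢j
  ... | no i≢i  | _       = contradiction refl i≢i

  level-dₓᵧ : level (d x y) ≡ 5
  level-dₓᵧ with y ≟ y | x ≟ x
  ... | yes _   | yes _   = refl
  ... | yes _   | no x≢x  = contradiction refl x≢x
  ... | no y≢y  | _       = contradiction refl y≢y

  H-near : ∀ u v → HEdge u v → ¬ InF i j x y u v → ∣ level u - level v ∣ ≤ 1
  H-near (b _ _ _) (b _ _ _) e             _   = offset-near e
  H-near (c _ _ _) (c _ _ _) e             _   = offset-near e
  H-near (a p q)   (b _ s _) (refl , refl) ∉F  =
    ab-near p q s false λ { (refl , refl , refl) → ∉F (inj₁ (inj₁ (refl , refl))) }
  H-near (b p q _) (c _ _ _) (refl , refl) _   = ≤-reflexive (∣n-1+n∣≡1 (offset p q))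
  H-near (c t q _) (d p _)   (refl , refl) ∉F  =
    cd-near t q false p λ { (refl , refl , refl) → ∉F (inj₁ (inj₂ (refl , refl))) }
  H-near (a _ _)   (a _ _)   ()
  H-near (a _ _)   (c _ _ _) ()
  H-near (a _ _)   (d _ _)   ()
  H-near (b _ _ _) (a _ _)   ()
  H-near (b _ _ _) (d _ _)   ()
  H-near (c _ _ _) (a _ _)   ()
  H-near (c _ _ _) (b _ _ _) ()
  H-near (d _ _)   _         ()

  M-near : ∀ u v → MEdge M u v → ∣ level u - level v ∣ ≤ 1
  M-near (a p q)   (b _ s _) (refl , refl , m) =
    ab-near p q s true λ { (refl , refl , refl) → contradiction (trans (sym m) Mijy) λ () }
  M-near (c t _ _) (d p q)   (refl , refl , m) =
    cd-near t q true p λ { (refl , refl , refl) → contradiction (trans (sym m) Mixy) λ () }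
  M-near (a _ _)   (a _ _)   ()
  M-near (a _ _)   (c _ _ _) ()
  M-near (a _ _)   (d _ _)   ()
  M-near (b _ _ _) _         ()
  M-near (c _ _ _) (a _ _)   ()
  M-near (c _ _ _) (b _ _ _) ()
  M-near (c _ _ _) (c _ _ _) ()
  M-near (d _ _)   _         ()

  directed-near : ∀ u v → HEdge u v ⊎ MEdge M u v → ¬ InF i j x y u v →
                  ∣ level u - level v ∣ ≤ 1
  directed-near u v (inj₁ e) ∉F = H-near u v e ∉F
  directed-near u v (inj₂ e) _  = M-near u v e

  level-lip : ∀ {u v} → R u v → ∣ level u - level v ∣ ≤ 1
  level-lip {u} {v} (inj₁ uv , ∉F) = directed-near u v uv ∉F
  level-lip {u} {v} (inj₂ vu , ∉F) =
    subst (_≤ 1) (∣-∣-comm (level v) (level u)) (directed-near v u vu (λ F → ∉F (swap F)))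

  diam≥5 : DiamGe R 5
  diam≥5 = a i j , d x y , λ dist →
    1+n≰n (subst (_≤ 4) (cong₂ ∣_-_∣ level-aᵢⱼ level-dₓᵧ) (∣-∣≤dist level level-lip dist))

lemma14 : (n : ℕ) → 1 ≤ n → (M : Fin n → Fin n → Fin n → Bool) →
          (i j x y : Fin n) → ¬ (i ≡ x) → ¬ (j ≡ y) →
          (M i j y ≡ true → M i x y ≡ true → DiamLe (GFAdj M i j x y) 3) ×
          (M i j y ≡ false → M i x y ≡ false → DiamGe (GFAdj M i j x y) 5)
lemma14 n _ M i j x y i≢x j≢y =
  UpperBound.diam≤3 M i j x y i≢x j≢y , LowerBound.diam≥5 M i j x y
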